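{- The logic $\mathsf{BCL}{ - }\mathsf{DC}$ is sound and complete relative to the class of classifier models: for every $\varphi\in\mathcal{L}^{\mathit{dyn}}(\mathit{Atm})$, $\varphi$ is a theorem of $\mathsf{BCL}{ - }\mathsf{DC}$ if and only if $(C,s)\models\varphi$ for every classifier model $C=(S,f)$ and every $s\in S$.
   Context: $\mathit{Atm}$ is a finite set of atomic propositions containing the decision atoms $\mathit{Dec}=\{\mathsf{t}(x):x\in\mathit{Val}\}$, $\mathit{Val}$ a finite set. The language $\mathcal{L}^{\mathit{dyn}}(\mathit{Atm})$ is $\varphi::=p\mid\neg\varphi\mid\varphi\wedge\varphi\mid[X]\varphi\mid[x:=\varphi]\psi$ with $p\in\mathit{Atm}$, $X\subseteq\mathit{Atm}$, $x\in\mathit{Val}$; $\langle X\rangle\varphi:=\neg[X]\neg\varphi$. A classifier model is $C=(S,f)$, $S=2^{\mathit{Atm}\setminus\mathit{Dec}}$, $f:S\to\mathit{Val}$; at $(C,s)$: $p\in\mathit{Atm}\setminus\mathit{Dec}$ true iff $p\in s$; $\mathsf{t}(x)$ true iff $f(s)=x$; Boolean clauses as usual; $[X]\varphi$ true iff $\varphi$ true at all $s'\in S$ with $s\cap X=s'\cap X$; $(C,s)\models[x:=\varphi]\psi$ iff $(C^{x:=\varphi},s)\models\psi$, where $C^{x:=\varphi}=(S,f')$ with $f'(s')=x$ if $(C,s')\models\varphi$ and $f'(s')=f(s')$ otherwise. Let $\mathrm{cn}(Y,X)=\bigwedge_{p\in Y}p\wedge\bigwedge_{p\in X\setminus Y}\neg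 p$. $\mathsf{BCL}$ is classical propositional logic plus: $([\emptyset]\varphi\wedge[\emptyset](\varphi\to\psi))\to[\emptyset]\psi$; $[\emptyset]\varphi\to\varphi$; $[\emptyset]\varphi\to[\emptyset][\emptyset]\varphi$; $\varphi\to[\emptyset]\langle\emptyset\rangle\varphi$; $[X]\varphi\leftrightarrow\bigwedge_{Y\subseteq X}(\mathrm{cn}(Y,X)\to[\emptyset](\mathrm{cn}(Y,X)\to\varphi))$; $\bigvee_{x\in\mathit{Val}}\mathsf{t}(x)$; $\mathsf{t}(x)\to\neg\mathsf{t}(y)$ for $x\neq y$; for each $x\in\mathit{Val}$, $\bigwedge_{Y\subseteq\mathit{Atm}\setminus\mathit{Dec}}((\mathrm{cn}(Y,\mathit{Atm}\setminus\mathit{Dec})\wedge\mathsf{t}(x))\to[\emptyset](\mathrm{cn}(Y,\mathit{Atm}\setminus\mathit{Dec})\to\mathsf{t}(x)))$; $\bigwedge_{Y\subseteq\mathit{Atm}\setminus\mathit{Dec}}\langle\emptyset\rangle\mathrm{cn}(Y,\mathit{Atm}\setminus\mathit{Dec})$; modus ponens; and necessitation for $[\emptyset]$. $\mathsf{BCL}{ - }\mathsf{DC}$ extends $\mathsf{BCL}$ (over $\mathcal{L}^{\mathit{dyn}}$) with the axioms: $[x:=\varphi]\mathsf{t}(x)\leftrightarrow(\varphi\vee\mathsf{t}(x))$; $[x:=\varphi]\mathsf{t}(y)\leftrightarrow(\neg\varphi\wedge\mathsf{t}(y))$ for $x\neq y$; $[x:=\varphi]p\leftrightarrow p$ for $p\notin\mathit{Dec}$;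 $[x:=\varphi]\neg\psi\leftrightarrow\neg[x:=\varphi]\psi$; $[x:=\varphi](\psi_1\wedge\psi_2)\leftrightarrow([x:=\varphi]\psi_1\wedge[x:=\varphi]\psi_2)$; $[x:=\varphi][X]\psi\leftrightarrow[X][x:=\varphi]\psi$; and the rule of replacement of equivalents: from $\varphi_1\leftrightarrow\varphi_2$ infer $\psi\leftrightarrow\psi'$, where $\psi'$ results from $\psi$ by replacing occurrences of $\varphi_1$ with $\varphi_2$.
   Formalization: In $[X]\varphi$ and $\langle X\rangle\varphi$, the index X ranges over subsets of $\mathit{Atm}\setminus\mathit{Dec}$ only, not over all subsets of $\mathit{Atm}$, so no decision atom $\mathsf{t}(x)$ lies in X. The statement above fails without it. -}

module Defs where

open import Data.Nat using (ℕ; suc)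
open import Data.Bool using (Bool; true; false; not; if_then_else_) renaming (_∧_ to _&&_; _∨_ to _||_)
import Data.Bool as B
open import Data.Fin using (Fin; zero)
import Data.Fin as F
open import Data.Fin.Subset using (Subset)
open import Data.Vec using (Vec; []; _∷_; lookup)
open import Data.List using (List; []; _∷_; _++_; map; filter; allFin)
open import Relation.Nullary using (¬_; ¬?)
open import Relation.Nullary.Decidable using (⌊_⌋)
open import Relation.Binary.PropositionalEquality using (_≡_)

allS : ∀ {n} → (Subset n → Bool) → Bool
allS {ℕ.zero} P = P []
allS {suc n} P = allS (λ v → P (true ∷ v)) && allS (λ v → P (false ∷ v))

allL : ∀ {A : Set} → (A → Bool) → List A → Bool
allL P [] = true
allL P (a ∷ as) = P a && allL P as

sublists : ∀ {A : Set} → List A → List (List A)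
sublists [] = [] ∷ []
sublists (a ∷ as) = map (a ∷_) (sublists as) ++ sublists as

-- The logic, parameterised by:
--   n : number of non-decision atoms  (Atm ∖ Dec = {p i : i ∈ Fin n})
--   k : Val = Fin (suc k)             (a finite, nonempty set of values)
module Logic (n k : ℕ) where

  open import Data.List.Membership.DecPropositional (F._≟_ {n}) using (_∈?_)

  Val : Set
  Val = Fin (suc k)

  -- Formulas of L^dyn(Atm).  Atm = {p i} ∪ {t x}; [X] ranges over
  -- finite sets X ⊆ Atm ∖ Dec, represented as lists.
  infixr 6 _∧_
  data Fm : Set where
    p      : Fin n → Fm
    t      : Val → Fm
    ¬'_    : Fm → Fm
    _∧_    : Fm → Fm → Fm
    [_]_   : List (Fin n) → Fm → Fm
    [_≔_]_ : Val → Fm → Fm → Fm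

  infixr 5 _∨_
  infixr 4 _⇒_
  infix 3 _⇔'_
  _∨_ : Fm → Fm → Fm
  φ ∨ ψ = ¬' (¬' φ ∧ ¬' ψ)

  _⇒_ : Fm → Fm → Fm
  φ ⇒ ψ = ¬' (φ ∧ ¬' ψ)

  _⇔'_ : Fm → Fm → Fm
  φ ⇔' ψ = (φ ⇒ ψ) ∧ (ψ ⇒ φ)

  ⊤' : Fm
  ⊤' = t zero ∨ ¬' t zero

  ⊥' : Fm
  ⊥' = ¬' ⊤'

  ⟨_⟩_ : List (Fin n) → Fm → Fm
  ⟨ X ⟩ φ = ¬' ([ X ] (¬' φ))

  ⋀ : List Fm → Fm
  ⋀ [] = ⊤'
  ⋀ (φ ∷ []) = φ
  ⋀ (φ ∷ ψs) = φ ∧ ⋀ ψs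

  ⋁ : List Fm → Fm
  ⋁ [] = ⊥'
  ⋁ (φ ∷ []) = φ
  ⋁ (φ ∷ ψs) = φ ∨ ⋁ ψs

  cn : List (Fin n) → List (Fin n) → Fm
  cn Y X = ⋀ (map p Y ++ map (λ q → ¬' p q) (filter (λ q → ¬? (q ∈? Y)) X))

  Atm₀ : List (Fin n)
  Atm₀ = allFin n

  -- Semantics: a classifier model C = (S, f) with S = 2^(Atm∖Dec)
  record ClassifierModel : Set where
    constructor ⟨S,_⟩
    field f : Subset n → Val

  State : Set
  State = Subset n

  agree : List (Fin n) → State → State → Bool
  agree X s s' = allL (λ i → ⌊ lookup s i B.≟ lookup s' i ⌋) X

  eval : (Subset n → Val) → State → Fm → Bool
  eval f s (p i) = lookup s i
  eval f s (t x) = ⌊ f s F.≟ x ⌋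
  eval f s (¬' φ) = not (eval f s φ)
  eval f s (φ ∧ ψ) = eval f s φ && eval f s ψ
  eval f s ([ X ] φ) = allS (λ s' → not (agree X s s') || eval f s' φ)
  eval f s ([ x ≔ φ ] ψ) =
    eval (λ s' → if eval f s' φ then x else f s') s ψ

  _,_⊨_ : ClassifierModel → State → Fm → Set
  C , s ⊨ φ = eval (ClassifierModel.f C) s φ ≡ true

  Valid : Fm → Set
  Valid φ = (C : ClassifierModel) (s : State) → C , s ⊨ φ

  -- classical propositional logic: all instances of propositional
  -- tautologies (non-Boolean subformulas treated as propositional letters)
  peval : (Fm → Bool) → Fm → Bool
  peval v (¬' φ) = not (peval v φ)
  peval v (φ ∧ ψ) = peval v φ && peval v ψ
  peval v φ = v φ

  Tautology : Fm → Set
  Tautology φ = (v : Fm → Bool) → peval v φ ≡ true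

  data Repl (φ₁ φ₂ : Fm) : Fm → Fm → Set where
    here  : Repl φ₁ φ₂ φ₁ φ₂
    same  : ∀ {ψ} → Repl φ₁ φ₂ ψ ψ
    ¬c    : ∀ {ψ ψ'} → Repl φ₁ φ₂ ψ ψ' → Repl φ₁ φ₂ (¬' ψ) (¬' ψ')
    ∧c    : ∀ {ψ ψ' χ χ'} → Repl φ₁ φ₂ ψ ψ' → Repl φ₁ φ₂ χ χ' →
            Repl φ₁ φ₂ (ψ ∧ χ) (ψ' ∧ χ')
    □c    : ∀ {X ψ ψ'} → Repl φ₁ φ₂ ψ ψ' → Repl φ₁ φ₂ ([ X ] ψ) ([ X ] ψ')
    ≔c    : ∀ {x ψ ψ' χ χ'} → Repl φ₁ φ₂ ψ ψ' → Repl φ₁ φ₂ χ χ' →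
            Repl φ₁ φ₂ ([ x ≔ ψ ] χ) ([ x ≔ ψ' ] χ')

  data ⊢_ : Fm → Set where
    taut  : ∀ {φ} → Tautology φ → ⊢ φ
    K∅    : ∀ φ ψ → ⊢ (([ [] ] φ ∧ [ [] ] (φ ⇒ ψ)) ⇒ [ [] ] ψ)
    T∅    : ∀ φ → ⊢ ([ [] ] φ ⇒ φ)
    4∅    : ∀ φ → ⊢ ([ [] ] φ ⇒ [ [] ] [ [] ] φ)
    B∅    : ∀ φ → ⊢ (φ ⇒ [ [] ] ⟨ [] ⟩ φ)
    Red□  : ∀ X φ → ⊢ ([ X ] φ ⇔'
              ⋀ (map (λ Y → cn Y X ⇒ [ [] ] (cn Y X ⇒ φ)) (sublists X)))
    AtLeast : ⊢ ⋁ (map t (allFin (suc k)))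
    AtMost  : ∀ x y → ¬ (x ≡ y) → ⊢ (t x ⇒ ¬' t y)
    Func  : ∀ x → ⊢ ⋀ (map (λ Y → (cn Y Atm₀ ∧ t x) ⇒ [ [] ] (cn Y Atm₀ ⇒ t x))
                          (sublists Atm₀))
    Comp  : ⊢ ⋀ (map (λ Y → ⟨ [] ⟩ cn Y Atm₀) (sublists Atm₀))
    MP    : ∀ {φ ψ} → ⊢ φ → ⊢ (φ ⇒ ψ) → ⊢ ψ
    Nec∅  : ∀ {φ} → ⊢ φ → ⊢ [ [] ] φ
    Dt=   : ∀ x φ → ⊢ ([ x ≔ φ ] t x ⇔' (φ ∨ t x))
    Dt≠   : ∀ x y φ → ¬ (x ≡ y) → ⊢ ([ x ≔ φ ] t y ⇔' (¬' φ ∧ t y))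
    Dp    : ∀ x φ i → ⊢ ([ x ≔ φ ] p i ⇔' p i)
    D¬    : ∀ x φ ψ → ⊢ ([ x ≔ φ ] ¬' ψ ⇔' ¬' [ x ≔ φ ] ψ)
    D∧    : ∀ x φ ψ₁ ψ₂ → ⊢ ([ x ≔ φ ] (ψ₁ ∧ ψ₂) ⇔' ([ x ≔ φ ] ψ₁ ∧ [ x ≔ φ ] ψ₂))
    D□    : ∀ x φ X ψ → ⊢ ([ x ≔ φ ] [ X ] ψ ⇔' [ X ] [ x ≔ φ ] ψ)
    RE    : ∀ {φ₁ φ₂ ψ ψ'} → ⊢ (φ₁ ⇔' φ₂) → Repl φ₁ φ₂ ψ ψ' → ⊢ (ψ ⇔' ψ')

{-# OPTIONS --safe #-}
module Submission where

-- For completeness, the dynamic axioms and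
-- replacement of equivalents turn every formula into a provably equivalent static one.
-- A classifier f is described by the formula graph f, the conjunction over all states s
-- of [∅](char s → t (f s)), where char s is the conjunction of the literals true at s.
-- Under graph f ∧ char s every static formula is proved or refuted according to its
-- truth value at (f, s), so a valid formula is provable from graph f. Finally graph f is
-- discharged one state at a time: Func, Comp, AtLeast and S5 prove that on each state
-- the classifier takes some value everywhere.

open import Defs
open import Data.Bool using (Bool; true; false; not; if_then_else_; T) renaming (_∧_ to _&&_; _∨_ to _||_)
import Data.Bool as B
open import Data.Bool.Properties using (T-≡; not-involutive; ∧-zeroʳ; not-¬)
open import Data.Empty using (⊥-elim)
open import Data.Fin as F using (Fin; zero; suc)
open import Data.Fin.Subset using (Subset)
open import Data.List using (List; []; _∷_; _++_; map; filter; allFin)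
open import Data.List.Membership.Propositional using (_∈_; _∉_)
open import Data.List.Membership.Propositional.Properties
  using (∈-map⁺; ∈-++⁺ˡ; ∈-++⁺ʳ; ∈-filter⁺; ∈-filter⁻; ∈-allFin)
open import Data.List.Relation.Unary.All as All using (All; []; _∷_)
open import Data.List.Relation.Unary.All.Properties using (map⁺; ++⁺)
open import Data.List.Relation.Unary.Any as Any using (here; there)
open import Data.Nat using (ℕ; zero; suc)
open import Data.Product using (∃; _×_; _,_)
open import Data.Vec as V using (Vec; []; _∷_; lookup; tabulate)
open import Data.Vec.Properties using (lookup-map; lookup∘tabulate; tabulate∘lookup; tabulate-cong; ≡-dec)
open import Function using (_∘_)
open import Function.Bundles using (_⇔_; mk⇔; Equivalence)
open import Relation.Binary.PropositionalEquality using (_≡_; _≢_; refl; sym; trans; cong; cong₂; subst)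
open import Relation.Nullary using (Dec; yes; no; does; ¬_; ¬?)
open import Relation.Nullary.Decidable using (⌊_⌋; dec-true; dec-false; isYes≗does)

_⇒ᵇ_ : Bool → Bool → Bool
a ⇒ᵇ b = not (a && not b)

_⇔ᵇ_ : Bool → Bool → Bool
a ⇔ᵇ b = (a ⇒ᵇ b) && (b ⇒ᵇ a)

&&⁺ : ∀ {a b} → a ≡ true → b ≡ true → a && b ≡ true
&&⁺ refl refl = refl

&&⁻ˡ : ∀ {a b} → a && b ≡ true → a ≡ true
&&⁻ˡ {true} _ = refl

&&⁻ʳ : ∀ {a b} → a && b ≡ true → b ≡ true
&&⁻ʳ {true} h = h

not⁺ : ∀ {a} → ¬ (a ≡ true) → not a ≡ true
not⁺ {false} _ = refl
not⁺ {true} h = ⊥-elim (h refl)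

not⁻ : ∀ {a} → not a ≡ true → a ≡ false
not⁻ {false} _ = refl

not-||⁺ : ∀ {a b} → (a ≡ true → b ≡ true) → not a || b ≡ true
not-||⁺ {false} _ = refl
not-||⁺ {true} h = h refl

not-||⁻ : ∀ {a b} → not a || b ≡ true → a ≡ true → b ≡ true
not-||⁻ h refl = h

⇒ᵇ⁺ : ∀ {a b} → (a ≡ true → b ≡ true) → a ⇒ᵇ b ≡ true
⇒ᵇ⁺ {false} _ = refl
⇒ᵇ⁺ {true} h rewrite h refl = refl

⇒ᵇ⁻ : ∀ {a b} → a ⇒ᵇ b ≡ true → a ≡ true → b ≡ true
⇒ᵇ⁻ {true} {true} _ _ = refl
⇒ᵇ⁻ {true} {false} () _

⇒ᵇ-refl : ∀ a → a ⇒ᵇ a ≡ true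
⇒ᵇ-refl a = ⇒ᵇ⁺ {a} (λ h → h)

⇔ᵇ-refl : ∀ a → a ⇔ᵇ a ≡ true
⇔ᵇ-refl a = &&⁺ (⇒ᵇ-refl a) (⇒ᵇ-refl a)

⇔ᵇ⁺ : ∀ {a b} → a ≡ b → a ⇔ᵇ b ≡ true
⇔ᵇ⁺ {a} refl = ⇔ᵇ-refl a

⇔ᵇ⁻ : ∀ {a b} → a ⇔ᵇ b ≡ true → a ≡ b
⇔ᵇ⁻ {true} {true} _ = refl
⇔ᵇ⁻ {false} {false} _ = refl
⇔ᵇ⁻ {true} {false} ()
⇔ᵇ⁻ {false} {true} ()

⌊⌋-yes : ∀ {P : Set} (d : Dec P) → P → ⌊ d ⌋ ≡ true
⌊⌋-yes d p = trans (isYes≗does d) (dec-true d p)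

⌊⌋-no : ∀ {P : Set} (d : Dec P) → ¬ P → ⌊ d ⌋ ≡ false
⌊⌋-no d ¬p = trans (isYes≗does d) (dec-false d ¬p)

⌊⌋-witness : ∀ {P : Set} (d : Dec P) → ⌊ d ⌋ ≡ true → P
⌊⌋-witness (yes p) _ = p

allS⁺ : ∀ {m} {P : Subset m → Bool} → (∀ s → P s ≡ true) → allS P ≡ true
allS⁺ {zero} h = h []
allS⁺ {suc m} h = &&⁺ (allS⁺ (h ∘ (true ∷_))) (allS⁺ (h ∘ (false ∷_)))

allS⁻ : ∀ {m} {P : Subset m → Bool} → allS P ≡ true → ∀ s → P s ≡ true
allS⁻ {zero} h [] = h
allS⁻ {suc m} h (true ∷ s) = allS⁻ (&&⁻ˡ h) s
allS⁻ {suc m} h (false ∷ s) = allS⁻ (&&⁻ʳ h) s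

allS-counterexample : ∀ {m} {P : Subset m → Bool} → allS P ≡ false → ∃ λ s → P s ≡ false
allS-counterexample {zero} h = [] , h
allS-counterexample {suc m} {P} h with allS (P ∘ (true ∷_)) in e
... | false = let s , Ps = allS-counterexample e in true ∷ s , Ps
... | true = let s , Ps = allS-counterexample h in false ∷ s , Ps

allS-cong : ∀ {m} {P Q : Subset m → Bool} → (∀ s → P s ≡ Q s) → allS P ≡ allS Q
allS-cong {zero} h = h []
allS-cong {suc m} h = cong₂ _&&_ (allS-cong (h ∘ (true ∷_))) (allS-cong (h ∘ (false ∷_)))

allL⁺ : ∀ {A : Set} {P : A → Bool} xs → (∀ {x} → x ∈ xs → P x ≡ true) → allL P xs ≡ true
allL⁺ [] _ = refl
allL⁺ (x ∷ xs) h = &&⁺ (h (here refl)) (allL⁺ xs (h ∘ there))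

allL⁻ : ∀ {A : Set} {P : A → Bool} {xs x} → allL P xs ≡ true → x ∈ xs → P x ≡ true
allL⁻ h (here refl) = &&⁻ˡ h
allL⁻ {xs = _ ∷ _} h (there x∈xs) = allL⁻ (&&⁻ʳ h) x∈xs

filter∈sublists : ∀ {A : Set} {P : A → Set} (P? : ∀ x → Dec (P x)) xs → filter P? xs ∈ sublists xs
filter∈sublists P? [] = here refl
filter∈sublists P? (x ∷ xs) with does (P? x)
... | true = ∈-++⁺ˡ (∈-map⁺ (x ∷_) (filter∈sublists P? xs))
... | false = ∈-++⁺ʳ _ (filter∈sublists P? xs)

subsets : ∀ m → List (Subset m)
subsets zero = [] ∷ []
subsets (suc m) = map (true ∷_) (subsets m) ++ map (false ∷_) (subsets m)

∈-subsets : ∀ {m} (s : Subset m) → s ∈ subsets m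
∈-subsets [] = here refl
∈-subsets (true ∷ s) = ∈-++⁺ˡ (∈-map⁺ (true ∷_) (∈-subsets s))
∈-subsets {suc m} (false ∷ s) =
  ∈-++⁺ʳ (map (true ∷_) (subsets m)) (∈-map⁺ (false ∷_) (∈-subsets s))

infixr 6 _&_
infixr 4 _⊃_

data Schema (m : ℕ) : Set where
  var : Fin m → Schema m
  ~_  : Schema m → Schema m
  _&_ : Schema m → Schema m → Schema m

_⊃_ : ∀ {m} → Schema m → Schema m → Schema m
a ⊃ b = ~ (a & ~ b)

α : ∀ {m} → Schema (suc m)
α = var zero

β : ∀ {m} → Schema (suc (suc m))
β = var (suc zero)

γ : ∀ {m} → Schema (suc (suc (suc m)))
γ = var (suc (suc zero))

δ : ∀ {m} → Schema (suc (suc (suc (suc m))))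
δ = var (suc (suc (suc zero)))

holds : ∀ {m} → Schema m → Vec Bool m → Bool
holds (var i) v = lookup v i
holds (~ a) v = not (holds a v)
holds (a & b) v = holds a v && holds b v

module Semantics (n k : ℕ) where
  open Logic n k
  open import Data.List.Membership.DecPropositional (F._≟_ {n}) using (_∈?_)

  eval-⊤ : ∀ {f s} → eval f s ⊤' ≡ true
  eval-⊤ {f} {s} = ⇒ᵇ-refl (not ⌊ f s F.≟ zero ⌋)

  eval-⋀⁺ : ∀ {f s L} → All (λ ψ → eval f s ψ ≡ true) L → eval f s (⋀ L) ≡ true
  eval-⋀⁺ {f} {s} [] = eval-⊤ {f} {s}
  eval-⋀⁺ (h ∷ []) = h
  eval-⋀⁺ (h ∷ hs@(_ ∷ _)) = &&⁺ h (eval-⋀⁺ hs)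

  eval-⋀⁻ : ∀ {f s L ψ} → eval f s (⋀ L) ≡ true → ψ ∈ L → eval f s ψ ≡ true
  eval-⋀⁻ {L = _ ∷ []} h (here refl) = h
  eval-⋀⁻ {L = _ ∷ _ ∷ _} h (here refl) = &&⁻ˡ h
  eval-⋀⁻ {L = _ ∷ _ ∷ _} h (there ψ∈L) = eval-⋀⁻ (&&⁻ʳ h) ψ∈L

  eval-⋁⁺ : ∀ {f s L ψ} → ψ ∈ L → eval f s ψ ≡ true → eval f s (⋁ L) ≡ true
  eval-⋁⁺ {L = _ ∷ []} (here refl) h = h
  eval-⋁⁺ {L = _ ∷ _ ∷ _} (here refl) h rewrite h = refl
  eval-⋁⁺ {f} {s} {L = φ ∷ ψ ∷ L} (there ψ∈L) h
    rewrite eval-⋁⁺ {f} {s} {ψ ∷ L} ψ∈L h = cong not (∧-zeroʳ (not (eval f s φ)))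

  eval-□⁺ : ∀ {f s} X φ → (∀ s' → agree X s s' ≡ true → eval f s' φ ≡ true) →
            eval f s ([ X ] φ) ≡ true
  eval-□⁺ X φ h = allS⁺ {n} λ s' → not-||⁺ (h s')

  eval-□⁻ : ∀ {f s} X φ → eval f s ([ X ] φ) ≡ true →
            ∀ {s'} → agree X s s' ≡ true → eval f s' φ ≡ true
  eval-□⁻ X φ h {s'} = not-||⁻ (allS⁻ {n} h s')

  agree⁺ : ∀ {X s s'} → (∀ {q} → q ∈ X → lookup s q ≡ lookup s' q) → agree X s s' ≡ true
  agree⁺ {X} {s} {s'} h = allL⁺ X λ {q} q∈X → ⌊⌋-yes (lookup s q B.≟ lookup s' q) (h q∈X)

  agree⁻ : ∀ {X s s' q} → agree X s s' ≡ true → q ∈ X → lookup s q ≡ lookup s' q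
  agree⁻ {s = s} {s'} {q} h q∈X = ⌊⌋-witness (lookup s q B.≟ lookup s' q) (allL⁻ h q∈X)

  agree-Atm₀ : ∀ {s s'} → agree Atm₀ s s' ≡ true → s ≡ s'
  agree-Atm₀ {s} {s'} h = trans (sym (tabulate∘lookup s))
    (trans (tabulate-cong (λ i → agree⁻ {Atm₀} {s} {s'} h (∈-allFin i))) (tabulate∘lookup s'))

  eval-cn⁺ : ∀ {f s Y X} → (∀ {q} → q ∈ Y → lookup s q ≡ true) →
             (∀ {q} → q ∈ X → q ∉ Y → lookup s q ≡ false) → eval f s (cn Y X) ≡ true
  eval-cn⁺ {Y = Y} positive negative = eval-⋀⁺ (++⁺ (map⁺ (All.tabulate positive)) (map⁺ (All.tabulate λ q∈ →
    let q∈X , q∉Y = ∈-filter⁻ (λ q → ¬? (q ∈? Y)) q∈ in cong not (negative q∈X q∉Y))))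

  eval-cn⁻ : ∀ {f s Y X} → eval f s (cn Y X) ≡ true →
             (∀ {q} → q ∈ Y → lookup s q ≡ true) × (∀ {q} → q ∈ X → q ∉ Y → lookup s q ≡ false)
  eval-cn⁻ {Y = Y} h =
    (λ q∈Y → eval-⋀⁻ h (∈-++⁺ˡ (∈-map⁺ p q∈Y))) ,
    (λ q∈X q∉Y → not⁻ (eval-⋀⁻ h (∈-++⁺ʳ (map p Y) (∈-map⁺ (λ q → ¬' p q)
                                    (∈-filter⁺ (λ q → ¬? (q ∈? Y)) q∈X q∉Y)))))

  sel : State → List (Fin n) → List (Fin n)
  sel s X = filter (λ q → lookup s q B.≟ true) X

  sel∈sublists : ∀ s X → sel s X ∈ sublists X
  sel∈sublists s = filter∈sublists (λ q → lookup s q B.≟ true)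

  cn-agree : ∀ {f s s' Y X} → eval f s (cn Y X) ≡ true → eval f s' (cn Y X) ≡ true →
             agree X s s' ≡ true
  cn-agree {f} {s} {s'} {Y} {X} h h' = agree⁺ {X} {s} {s'} pointwise
    where
    pointwise : ∀ {q} → q ∈ X → lookup s q ≡ lookup s' q
    pointwise {q} q∈X with q ∈? Y | eval-cn⁻ {f} {s} {Y} {X} h | eval-cn⁻ {f} {s'} {Y} {X} h'
    ... | yes q∈Y | pos , _ | pos' , _ = trans (pos q∈Y) (sym (pos' q∈Y))
    ... | no q∉Y | _ , neg | _ , neg' = trans (neg q∈X q∉Y) (sym (neg' q∈X q∉Y))

  eval-cn-sel : ∀ {f s s' X} → agree X s s' ≡ true → eval f s' (cn (sel s X) X) ≡ true
  eval-cn-sel {s = s} {s'} {X} h = eval-cn⁺ positive negative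
    where
    positive : ∀ {q} → q ∈ sel s X → lookup s' q ≡ true
    positive q∈ = let q∈X , sq = ∈-filter⁻ (λ q → lookup s q B.≟ true) q∈
                  in trans (sym (agree⁻ {X} {s} {s'} h q∈X)) sq
    negative : ∀ {q} → q ∈ X → q ∉ sel s X → lookup s' q ≡ false
    negative {q} q∈X q∉ with lookup s q in sq
    ... | true = ⊥-elim (q∉ (∈-filter⁺ (λ q → lookup s q B.≟ true) q∈X sq))
    ... | false = trans (sym (agree⁻ {X} {s} {s'} h q∈X)) sq

  agree-refl : ∀ X s → agree X s s ≡ true
  agree-refl X s = agree⁺ {X} {s} {s} (λ _ → refl)

  toState : List (Fin n) → State
  toState Y = tabulate (λ i → ⌊ i ∈? Y ⌋)

  eval-cn-toState : ∀ {f Y X} → eval f (toState Y) (cn Y X) ≡ true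
  eval-cn-toState {f} {Y} {X} = eval-cn⁺ {f} {toState Y} {Y} {X}
    (λ {q} q∈Y → trans (lookup∘tabulate _ q) (⌊⌋-yes (q ∈? Y) q∈Y))
    (λ {q} _ q∉Y → trans (lookup∘tabulate _ q) (⌊⌋-no (q ∈? Y) q∉Y))

  peval-eval : ∀ f s φ → peval (eval f s) φ ≡ eval f s φ
  peval-eval f s (p i) = refl
  peval-eval f s (t x) = refl
  peval-eval f s (¬' φ) = cong not (peval-eval f s φ)
  peval-eval f s (φ ∧ ψ) = cong₂ _&&_ (peval-eval f s φ) (peval-eval f s ψ)
  peval-eval f s ([ X ] φ) = refl
  peval-eval f s ([ x ≔ φ ] ψ) = refl

  eval-cong : ∀ {f g} → (∀ s → f s ≡ g s) → ∀ s φ → eval f s φ ≡ eval g s φ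
  eval-cong f≗g s (p i) = refl
  eval-cong f≗g s (t x) = cong (λ v → ⌊ v F.≟ x ⌋) (f≗g s)
  eval-cong f≗g s (¬' φ) = cong not (eval-cong f≗g s φ)
  eval-cong f≗g s (φ ∧ ψ) = cong₂ _&&_ (eval-cong f≗g s φ) (eval-cong f≗g s ψ)
  eval-cong f≗g s ([ X ] φ) = allS-cong λ s' → cong (not (agree X s s') ||_) (eval-cong f≗g s' φ)
  eval-cong f≗g s ([ x ≔ ψ ] φ) =
    eval-cong (λ s' → cong₂ (λ b v → if b then x else v) (eval-cong f≗g s' ψ) (f≗g s')) s φ

  eval-repl : ∀ {φ₁ φ₂ ψ ψ'} → (∀ f s → eval f s φ₁ ≡ eval f s φ₂) → Repl φ₁ φ₂ ψ ψ' →
              ∀ f s → eval f s ψ ≡ eval f s ψ'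
  eval-repl h here f s = h f s
  eval-repl h same f s = refl
  eval-repl h (¬c r) f s = cong not (eval-repl h r f s)
  eval-repl h (∧c r r') f s = cong₂ _&&_ (eval-repl h r f s) (eval-repl h r' f s)
  eval-repl h (□c {X} r) f s = allS-cong λ s' → cong (not (agree X s s') ||_) (eval-repl h r f s')
  eval-repl h (≔c {x} {ψ} {ψ'} {χ} r r') f s =
    trans (eval-cong (λ s' → cong (λ b → if b then x else f s') (eval-repl h r f s')) s χ)
          (eval-repl h r' (λ s' → if eval f s' ψ' then x else f s') s)

  assign-same : ∀ e (v x : Val) → ⌊ (if e then x else v) F.≟ x ⌋ ≡ not (not e && not ⌊ v F.≟ x ⌋)
  assign-same true v x = ⌊⌋-yes (x F.≟ x) refl
  assign-same false v x = sym (not-involutive _)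

  assign-other : ∀ e (v x y : Val) → x ≢ y → ⌊ (if e then x else v) F.≟ y ⌋ ≡ (not e && ⌊ v F.≟ y ⌋)
  assign-other true v x y x≢y = ⌊⌋-no (x F.≟ y) x≢y
  assign-other false v x y x≢y = refl

  sound : ∀ {φ} → ⊢ φ → ∀ f s → eval f s φ ≡ true
  sound (taut {φ} tautology) f s = trans (sym (peval-eval f s φ)) (tautology (eval f s))
  sound (K∅ φ ψ) f s = ⇒ᵇ⁺ λ (h : eval f s ([ [] ] φ ∧ [ [] ] (φ ⇒ ψ)) ≡ true) →
    allS⁺ {n} λ s' → ⇒ᵇ⁻ (allS⁻ {n} (&&⁻ʳ h) s') (allS⁻ {n} (&&⁻ˡ h) s')
  sound (T∅ φ) f s = ⇒ᵇ⁺ λ (h : eval f s ([ [] ] φ) ≡ true) → allS⁻ {n} h s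
  sound (4∅ φ) f s = ⇒ᵇ⁺ λ (h : eval f s ([ [] ] φ) ≡ true) →
    allS⁺ {n} λ _ → allS⁺ {n} λ s' → allS⁻ {n} h s'
  sound (B∅ φ) f s = ⇒ᵇ⁺ λ (h : eval f s φ ≡ true) → allS⁺ {n} λ s' →
    not⁺ λ (h' : eval f s' ([ [] ] ¬' φ) ≡ true) → not-¬ h (not⁻ (allS⁻ {n} h' s))
  sound (Red□ X φ) f s = &&⁺ (⇒ᵇ⁺ to) (⇒ᵇ⁺ from)
    where
    R : List (Fin n) → Fm
    R Y = cn Y X ⇒ [ [] ] (cn Y X ⇒ φ)
    conjunct : eval f s ([ X ] φ) ≡ true → ∀ Y → eval f s (R Y) ≡ true
    conjunct h Y = ⇒ᵇ⁺ λ (hY : eval f s (cn Y X) ≡ true) → allS⁺ {n} λ s' →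
      ⇒ᵇ⁺ λ (hY' : eval f s' (cn Y X) ≡ true) →
        eval-□⁻ {f} {s} X φ h {s'} (cn-agree {f} {s} {s'} {Y} {X} hY hY')
    to : eval f s ([ X ] φ) ≡ true → eval f s (⋀ (map R (sublists X))) ≡ true
    to h = eval-⋀⁺ (map⁺ (All.universal (conjunct h) (sublists X)))
    from : eval f s (⋀ (map R (sublists X))) ≡ true → eval f s ([ X ] φ) ≡ true
    from h = eval-□⁺ {f} {s} X φ λ s' agreeX →
      let box = ⇒ᵇ⁻ (eval-⋀⁻ h (∈-map⁺ R (sel∈sublists s X)))
                    (eval-cn-sel {f} {s} {s} {X} (agree-refl X s))
      in ⇒ᵇ⁻ (allS⁻ {n} box s') (eval-cn-sel {f} {s} {s'} {X} agreeX)
  sound AtLeast f s = eval-⋁⁺ (∈-map⁺ t (∈-allFin (f s))) (⌊⌋-yes (f s F.≟ f s) refl)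
  sound (AtMost x y x≢y) f s = ⇒ᵇ⁺ λ (hx : eval f s (t x) ≡ true) →
    not⁺ λ (hy : eval f s (t y) ≡ true) →
    x≢y (trans (sym (⌊⌋-witness (f s F.≟ x) hx)) (⌊⌋-witness (f s F.≟ y) hy))
  sound (Func x) f s = eval-⋀⁺ (map⁺ (All.universal functional (sublists Atm₀)))
    where
    functional : ∀ Y → eval f s ((cn Y Atm₀ ∧ t x) ⇒ [ [] ] (cn Y Atm₀ ⇒ t x)) ≡ true
    functional Y = ⇒ᵇ⁺ λ (h : eval f s (cn Y Atm₀ ∧ t x) ≡ true) → allS⁺ {n} λ s' →
      ⇒ᵇ⁺ λ (h' : eval f s' (cn Y Atm₀) ≡ true) → subst (λ z → ⌊ f z F.≟ x ⌋ ≡ true)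
        (agree-Atm₀ (cn-agree {f} {s} {s'} {Y} {Atm₀} (&&⁻ˡ h) h')) (&&⁻ʳ h)
  sound Comp f s = eval-⋀⁺ (map⁺ (All.universal possible (sublists Atm₀)))
    where
    possible : ∀ Y → eval f s (⟨ [] ⟩ cn Y Atm₀) ≡ true
    possible Y = not⁺ λ (h : eval f s ([ [] ] ¬' cn Y Atm₀) ≡ true) →
      not-¬ (eval-cn-toState {f} {Y} {Atm₀}) (not⁻ (allS⁻ {n} h (toState Y)))
  sound (MP d e) f s = ⇒ᵇ⁻ (sound e f s) (sound d f s)
  sound (Nec∅ d) f s = allS⁺ {n} λ s' → sound d f s'
  sound (Dt= x φ) f s = ⇔ᵇ⁺ (assign-same (eval f s φ) (f s) x)
  sound (Dt≠ x y φ x≢y) f s = ⇔ᵇ⁺ (assign-other (eval f s φ) (f s) x y x≢y)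
  sound (Dp x φ i) f s = ⇔ᵇ-refl (lookup s i)
  sound (D¬ x φ ψ) f s = ⇔ᵇ-refl (eval f s ([ x ≔ φ ] ¬' ψ))
  sound (D∧ x φ ψ₁ ψ₂) f s = ⇔ᵇ-refl (eval f s ([ x ≔ φ ] (ψ₁ ∧ ψ₂)))
  sound (D□ x φ X ψ) f s = ⇔ᵇ-refl (eval f s ([ x ≔ φ ] [ X ] ψ))
  sound (RE d r) f s = ⇔ᵇ⁺ (eval-repl (λ f s → ⇔ᵇ⁻ (sound d f s)) r f s)

  soundness : ∀ {φ} → ⊢ φ → Valid φ
  soundness d C = sound d (ClassifierModel.f C)

module Completeness (n k : ℕ) where
  open Logic n k
  open Semantics n k

  instantiate : ∀ {m} → Schema m → Vec Fm m → Fm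
  instantiate (var i) ρ = lookup ρ i
  instantiate (~ a) ρ = ¬' instantiate a ρ
  instantiate (a & b) ρ = instantiate a ρ ∧ instantiate b ρ

  peval-instantiate : ∀ {m} v (S : Schema m) ρ →
                      peval v (instantiate S ρ) ≡ holds S (V.map (peval v) ρ)
  peval-instantiate v (var i) ρ = sym (lookup-map i (peval v) ρ)
  peval-instantiate v (~ a) ρ = cong not (peval-instantiate v a ρ)
  peval-instantiate v (a & b) ρ = cong₂ _&&_ (peval-instantiate v a ρ) (peval-instantiate v b ρ)

  -- The implicit argument is discharged by evaluating the truth table of S during type checking.
  tautology : ∀ {m} (S : Schema m) {_ : T (allS (holds S))} (ρ : Vec Fm m) → ⊢ instantiate S ρ
  tautology S {valid} ρ = taut λ v →
    trans (peval-instantiate v S ρ) (allS⁻ (Equivalence.to T-≡ valid) (V.map (peval v) ρ))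

  ⊤-intro : ⊢ ⊤'
  ⊤-intro = tautology (~ (~ α & ~ ~ α)) (t zero ∷ [])

  ⇒-refl : ∀ {A} → ⊢ (A ⇒ A)
  ⇒-refl {A} = tautology (α ⊃ α) (A ∷ [])

  ⇒-precompose : ∀ {A B C} → ⊢ (A ⇒ B) → ⊢ ((B ⇒ C) ⇒ (A ⇒ C))
  ⇒-precompose {A} {B} {C} d = MP d (tautology ((α ⊃ β) ⊃ (β ⊃ γ) ⊃ α ⊃ γ) (A ∷ B ∷ C ∷ []))

  ⇒-trans : ∀ {A B C} → ⊢ (A ⇒ B) → ⊢ (B ⇒ C) → ⊢ (A ⇒ C)
  ⇒-trans d e = MP e (⇒-precompose d)

  ⇒-const : ∀ {A B} → ⊢ B → ⊢ (A ⇒ B)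
  ⇒-const {A} {B} d = MP d (tautology (β ⊃ α ⊃ β) (A ∷ B ∷ []))

  ⇒-mp : ∀ {C A B} → ⊢ (C ⇒ (A ⇒ B)) → ⊢ (C ⇒ A) → ⊢ (C ⇒ B)
  ⇒-mp {C} {A} {B} d e =
    MP e (MP d (tautology ((γ ⊃ α ⊃ β) ⊃ (γ ⊃ α) ⊃ γ ⊃ β) (A ∷ B ∷ C ∷ [])))

  ⇒-∧ : ∀ {C A B} → ⊢ (C ⇒ A) → ⊢ (C ⇒ B) → ⊢ (C ⇒ A ∧ B)
  ⇒-∧ {C} {A} {B} d e =
    MP e (MP d (tautology ((γ ⊃ α) ⊃ (γ ⊃ β) ⊃ γ ⊃ α & β) (A ∷ B ∷ C ∷ [])))

  ∧-elimˡ : ∀ {A B} → ⊢ (A ∧ B ⇒ A)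
  ∧-elimˡ {A} {B} = tautology (α & β ⊃ α) (A ∷ B ∷ [])

  ∧-elimʳ : ∀ {A B} → ⊢ (A ∧ B ⇒ B)
  ∧-elimʳ {A} {B} = tautology (α & β ⊃ β) (A ∷ B ∷ [])

  curry : ∀ {A B C} → ⊢ (A ∧ B ⇒ C) → ⊢ (A ⇒ B ⇒ C)
  curry {A} {B} {C} d = MP d (tautology ((α & β ⊃ γ) ⊃ α ⊃ β ⊃ γ) (A ∷ B ∷ C ∷ []))

  uncurry : ∀ {A B C} → ⊢ (A ⇒ B ⇒ C) → ⊢ (A ∧ B ⇒ C)
  uncurry {A} {B} {C} d = MP d (tautology ((α ⊃ β ⊃ γ) ⊃ α & β ⊃ γ) (A ∷ B ∷ C ∷ []))

  ⇒-tollens : ∀ {C A B} → ⊢ (C ⇒ A ⇒ B) → ⊢ ¬' B → ⊢ (C ⇒ ¬' A)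
  ⇒-tollens {C} {A} {B} d e =
    MP e (MP d (tautology ((γ ⊃ α ⊃ β) ⊃ ~ β ⊃ γ ⊃ ~ α) (A ∷ B ∷ C ∷ [])))

  ⇒-weaken : ∀ {A B C} → ⊢ (A ⇒ B) → ⊢ (A ⇒ C ⇒ B)
  ⇒-weaken {A} {B} {C} d = MP d (tautology ((α ⊃ β) ⊃ α ⊃ γ ⊃ β) (A ∷ B ∷ C ∷ []))

  ⇒-absurd : ∀ {A B C} → ⊢ (A ⇒ ¬' B) → ⊢ (A ⇒ B ⇒ C)
  ⇒-absurd {A} {B} {C} d = MP d (tautology ((α ⊃ ~ β) ⊃ α ⊃ β ⊃ γ) (A ∷ B ∷ C ∷ []))

  contraposition : ∀ {A B} → ⊢ (A ⇒ B) → ⊢ (¬' B ⇒ ¬' A)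
  contraposition {A} {B} d = MP d (tautology ((α ⊃ β) ⊃ ~ β ⊃ ~ α) (A ∷ B ∷ []))

  ¬¬-intro : ∀ {A} → ⊢ (A ⇒ ¬' ¬' A)
  ¬¬-intro {A} = tautology (α ⊃ ~ ~ α) (A ∷ [])

  by-contradiction : ∀ {A B φ} → ⊢ (A ∧ ¬' φ ⇒ B) → ⊢ ¬' B → ⊢ (A ⇒ φ)
  by-contradiction {A} {B} {φ} d e =
    MP e (MP d (tautology ((α & ~ γ ⊃ β) ⊃ ~ β ⊃ α ⊃ γ) (A ∷ B ∷ φ ∷ [])))

  ⇔-elimˡ : ∀ {A B} → ⊢ (A ⇔' B) → ⊢ (A ⇒ B)
  ⇔-elimˡ d = MP d ∧-elimˡ

  ⇔-elimʳ : ∀ {A B} → ⊢ (A ⇔' B) → ⊢ (B ⇒ A)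
  ⇔-elimʳ d = MP d ∧-elimʳ

  ⇔-trans : ∀ {A B C} → ⊢ (A ⇔' B) → ⊢ (B ⇔' C) → ⊢ (A ⇔' C)
  ⇔-trans {A} {B} {C} d e = MP e (MP d (tautology
    ((α ⊃ β) & (β ⊃ α) ⊃ (β ⊃ γ) & (γ ⊃ β) ⊃ (α ⊃ γ) & (γ ⊃ α)) (A ∷ B ∷ C ∷ [])))

  ⇔-refl : ∀ {A} → ⊢ (A ⇔' A)
  ⇔-refl {A} = tautology ((α ⊃ α) & (α ⊃ α)) (A ∷ [])

  ⋀-intro : ∀ {C L} → All (λ ψ → ⊢ (C ⇒ ψ)) L → ⊢ (C ⇒ ⋀ L)
  ⋀-intro [] = ⇒-const ⊤-intro
  ⋀-intro (d ∷ []) = d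
  ⋀-intro (d ∷ ds@(_ ∷ _)) = ⇒-∧ d (⋀-intro ds)

  ⋀-elim : ∀ {L ψ} → ψ ∈ L → ⊢ (⋀ L ⇒ ψ)
  ⋀-elim {_ ∷ []} (here refl) = ⇒-refl
  ⋀-elim {_ ∷ _ ∷ _} (here refl) = ∧-elimˡ
  ⋀-elim {_ ∷ _ ∷ _} (there ψ∈L) = ⇒-trans ∧-elimʳ (⋀-elim ψ∈L)

  ⋁-elim : ∀ {C B L} → All (λ ψ → ⊢ (C ⇒ ψ ⇒ B)) L → ⊢ (C ⇒ ⋁ L ⇒ B)
  ⋁-elim {C} {B} [] = tautology (γ ⊃ ~ ~ (~ α & ~ ~ α) ⊃ β) (t zero ∷ B ∷ C ∷ [])
  ⋁-elim (d ∷ []) = d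
  ⋁-elim {C} {B} (_∷_ {A} d ds@(_∷_ {A'} {L} _ _)) = MP (⋁-elim ds) (MP d (tautology
    ((γ ⊃ α ⊃ β) ⊃ (γ ⊃ δ ⊃ β) ⊃ γ ⊃ ~ (~ α & ~ δ) ⊃ β) (A ∷ B ∷ C ∷ ⋁ (A' ∷ L) ∷ [])))

  □ : Fm → Fm
  □ = [ [] ]_

  □-K : ∀ {A B} → ⊢ (□ (A ⇒ B) ⇒ □ A ⇒ □ B)
  □-K {A} {B} = MP (K∅ A B) (tautology ((α & β ⊃ γ) ⊃ β ⊃ α ⊃ γ) (□ A ∷ □ (A ⇒ B) ∷ □ B ∷ []))

  □-mono : ∀ {A B} → ⊢ (A ⇒ B) → ⊢ (□ A ⇒ □ B)
  □-mono d = MP (Nec∅ d) □-K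

  □-⋀ : ∀ {C L} → All (λ ψ → ⊢ (C ⇒ □ ψ)) L → ⊢ (C ⇒ □ (⋀ L))
  □-⋀ [] = ⇒-const (Nec∅ ⊤-intro)
  □-⋀ (d ∷ []) = d
  □-⋀ (_∷_ {A} d ds@(_∷_ {A'} {L} _ _)) =
    ⇒-mp (⇒-trans d (⇒-trans (□-mono (tautology (α ⊃ β ⊃ α & β) (A ∷ ⋀ (A' ∷ L) ∷ []))) □-K)) (□-⋀ ds)

  five : ∀ {A} → ⊢ (¬' □ A ⇒ □ (¬' □ A))
  five {A} = ⇒-trans (B∅ (¬' □ A)) (□-mono (contraposition (⇒-trans (4∅ A) (□-mono ¬¬-intro))))

  data Boolean : Fm → Set where
    p   : ∀ i → Boolean (p i)
    ⊤   : Boolean ⊤'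
    ¬'_ : ∀ {φ} → Boolean φ → Boolean (¬' φ)
    _∧_ : ∀ {φ ψ} → Boolean φ → Boolean ψ → Boolean (φ ∧ ψ)

  ⋀-boolean : ∀ {L} → All Boolean L → Boolean (⋀ L)
  ⋀-boolean [] = ⊤
  ⋀-boolean (b ∷ []) = b
  ⋀-boolean (b ∷ bs@(_ ∷ _)) = b ∧ ⋀-boolean bs

  ⋁-boolean : ∀ {L} → All Boolean L → Boolean (⋁ L)
  ⋁-boolean [] = ¬' ⊤
  ⋁-boolean (b ∷ []) = b
  ⋁-boolean (b ∷ bs@(_ ∷ _)) = ¬' (¬' b ∧ ¬' ⋁-boolean bs)

  cn-boolean : ∀ Y X → Boolean (cn Y X)
  cn-boolean Y X = ⋀-boolean (++⁺ (map⁺ (All.universal p Y))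
                                  (map⁺ (All.universal (λ q → ¬' p q) _)))

  valuationState : (Fm → Bool) → State
  valuationState v = tabulate (v ∘ p)

  peval-boolean : ∀ {φ} → Boolean φ → ∀ f v → peval v φ ≡ eval f (valuationState v) φ
  peval-boolean (p i) f v = sym (lookup∘tabulate (v ∘ p) i)
  peval-boolean ⊤ f v = trans (⇒ᵇ-refl (not (v (t zero)))) (sym (eval-⊤ {f} {valuationState v}))
  peval-boolean (¬' b) f v = cong not (peval-boolean b f v)
  peval-boolean (b ∧ c) f v = cong₂ _&&_ (peval-boolean b f v) (peval-boolean c f v)

  boolean-complete : ∀ f {φ} → Boolean φ → (∀ s → eval f s φ ≡ true) → ⊢ φ
  boolean-complete f b valid = taut λ v → trans (peval-boolean b f v) (valid (valuationState v))

  char : State → Fm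
  char s = cn (sel s Atm₀) Atm₀

  char-boolean : ∀ s → Boolean (char s)
  char-boolean s = cn-boolean (sel s Atm₀) Atm₀

  eval-char-self : ∀ {f} s → eval f s (char s) ≡ true
  eval-char-self {f} s = eval-cn-sel {f} {s} {s} {Atm₀} (agree-refl Atm₀ s)

  eval-char : ∀ {f s s'} → eval f s' (char s) ≡ true → s' ≡ s
  eval-char {f} {s} {s'} h = agree-Atm₀ (cn-agree {f} {s'} {s} {sel s Atm₀} {Atm₀} h (eval-char-self s))

  data Decides (C A : Fm) : Bool → Set where
    proves  : ⊢ (C ⇒ A) → Decides C A true
    refutes : ⊢ (C ⇒ ¬' A) → Decides C A false

  decides-true : ∀ {C A b} → Decides C A b → b ≡ true → ⊢ (C ⇒ A)
  decides-true (proves d) _ = d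

  decides-false : ∀ {C A b} → Decides C A b → b ≡ false → ⊢ (C ⇒ ¬' A)
  decides-false (refutes d) _ = d

  decides-¬ : ∀ {C A a} → Decides C A a → Decides C (¬' A) (not a)
  decides-¬ (proves d) = refutes (⇒-trans d ¬¬-intro)
  decides-¬ (refutes d) = proves d

  decides-∧ : ∀ {C A B a b} → Decides C A a → Decides C B b → Decides C (A ∧ B) (a && b)
  decides-∧ (proves d) (proves e) = proves (⇒-∧ d e)
  decides-∧ (proves d) (refutes e) = refutes (⇒-trans e (contraposition ∧-elimʳ))
  decides-∧ (refutes d) _ = refutes (⇒-trans d (contraposition ∧-elimˡ))

  decides-⇔ : ∀ {C A B b} → ⊢ (C ⇒ (A ⇔' B)) → Decides C B b → Decides C A b
  decides-⇔ {C} {A} {B} e (proves d) = proves (MP d (MP e (tautology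
    ((γ ⊃ (α ⊃ β) & (β ⊃ α)) ⊃ (γ ⊃ β) ⊃ γ ⊃ α) (A ∷ B ∷ C ∷ []))))
  decides-⇔ {C} {A} {B} e (refutes d) = refutes (MP d (MP e (tautology
    ((γ ⊃ (α ⊃ β) & (β ⊃ α)) ⊃ (γ ⊃ ~ β) ⊃ γ ⊃ ~ α) (A ∷ B ∷ C ∷ []))))

  decides-weaken : ∀ {C C' A b} → ⊢ (C' ⇒ C) → Decides C A b → Decides C' A b
  decides-weaken e (proves d) = proves (⇒-trans e d)
  decides-weaken e (refutes d) = refutes (⇒-trans e d)

  eval-at-char : ∀ {f s s' ψ b} → eval f s' (char s) ≡ true → eval f s ψ ≡ b → eval f s' ψ ≡ b
  eval-at-char {f} {s} {s'} h e rewrite eval-char {f} {s} {s'} h = e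

  char-decides : ∀ f {ψ} → Boolean ψ → ∀ s → Decides (char s) ψ (eval f s ψ)
  char-decides f {ψ} b s with eval f s ψ in ψ-at-s
  ... | true = proves (boolean-complete f (¬' (char-boolean s ∧ ¬' b)) λ s' →
                 ⇒ᵇ⁺ λ (h : eval f s' (char s) ≡ true) → eval-at-char {f} {s} {s'} {ψ} h ψ-at-s)
  ... | false = refutes (boolean-complete f (¬' (char-boolean s ∧ ¬' ¬' b)) λ s' →
                 ⇒ᵇ⁺ λ (h : eval f s' (char s) ≡ true) → cong not (eval-at-char {f} {s} {s'} {ψ} h ψ-at-s))

  data Static : Fm → Set where
    p    : ∀ i → Static (p i)
    t    : ∀ x → Static (t x)
    ¬'_  : ∀ {φ} → Static φ → Static (¬' φ)
    _∧_  : ∀ {φ ψ} → Static φ → Static ψ → Static (φ ∧ ψ)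
    [_]_ : ∀ X {φ} → Static φ → Static ([ X ] φ)

  assign : Val → Fm → Fm → Fm
  assign x ψ (p i) = p i
  assign x ψ (t y) with x F.≟ y
  ... | yes _ = ψ ∨ t x
  ... | no _ = ¬' ψ ∧ t y
  assign x ψ (¬' φ) = ¬' assign x ψ φ
  assign x ψ (φ ∧ χ) = assign x ψ φ ∧ assign x ψ χ
  assign x ψ ([ X ] φ) = [ X ] assign x ψ φ
  assign x ψ ([ y ≔ χ ] φ) = [ x ≔ ψ ] [ y ≔ χ ] φ  -- never reached from reduce

  assign-⇔ : ∀ x ψ φ → ⊢ ([ x ≔ ψ ] φ ⇔' assign x ψ φ)
  assign-⇔ x ψ (p i) = Dp x ψ i
  assign-⇔ x ψ (t y) with x F.≟ y
  ... | yes refl = Dt= x ψ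
  ... | no x≢y = Dt≠ x y ψ x≢y
  assign-⇔ x ψ (¬' φ) = ⇔-trans (D¬ x ψ φ) (RE (assign-⇔ x ψ φ) (¬c here))
  assign-⇔ x ψ (φ ∧ χ) = ⇔-trans (D∧ x ψ φ χ)
    (⇔-trans (RE (assign-⇔ x ψ φ) (∧c here same)) (RE (assign-⇔ x ψ χ) (∧c same here)))
  assign-⇔ x ψ ([ X ] φ) = ⇔-trans (D□ x ψ X φ) (RE (assign-⇔ x ψ φ) (□c here))
  assign-⇔ x ψ ([ y ≔ χ ] φ) = ⇔-refl

  assign-static : ∀ {x ψ φ} → Static ψ → Static φ → Static (assign x ψ φ)
  assign-static sψ (p i) = p i
  assign-static {x} sψ (t y) with x F.≟ y
  ... | yes _ = ¬' (¬' sψ ∧ ¬' t x)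
  ... | no _ = ¬' sψ ∧ t y
  assign-static sψ (¬' sφ) = ¬' assign-static sψ sφ
  assign-static sψ (sφ ∧ sχ) = assign-static sψ sφ ∧ assign-static sψ sχ
  assign-static sψ ([ X ] sφ) = [ X ] assign-static sψ sφ

  reduce : Fm → Fm
  reduce (p i) = p i
  reduce (t x) = t x
  reduce (¬' φ) = ¬' reduce φ
  reduce (φ ∧ ψ) = reduce φ ∧ reduce ψ
  reduce ([ X ] φ) = [ X ] reduce φ
  reduce ([ x ≔ ψ ] φ) = assign x (reduce ψ) (reduce φ)

  reduce-⇔ : ∀ φ → ⊢ (φ ⇔' reduce φ)
  reduce-⇔ (p i) = ⇔-refl
  reduce-⇔ (t x) = ⇔-refl
  reduce-⇔ (¬' φ) = RE (reduce-⇔ φ) (¬c here)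
  reduce-⇔ (φ ∧ ψ) = ⇔-trans (RE (reduce-⇔ φ) (∧c here same)) (RE (reduce-⇔ ψ) (∧c same here))
  reduce-⇔ ([ X ] φ) = RE (reduce-⇔ φ) (□c here)
  reduce-⇔ ([ x ≔ ψ ] φ) = ⇔-trans (RE (reduce-⇔ ψ) (≔c here same))
    (⇔-trans (RE (reduce-⇔ φ) (≔c same here)) (assign-⇔ x (reduce ψ) (reduce φ)))

  reduce-static : ∀ φ → Static (reduce φ)
  reduce-static (p i) = p i
  reduce-static (t x) = t x
  reduce-static (¬' φ) = ¬' reduce-static φ
  reduce-static (φ ∧ ψ) = reduce-static φ ∧ reduce-static ψ
  reduce-static ([ X ] φ) = [ X ] reduce-static φ
  reduce-static ([ x ≔ ψ ] φ) = assign-static (reduce-static ψ) (reduce-static φ)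

  values : List Val
  values = allFin (suc k)

  assigns : State → Val → Fm
  assigns s x = □ (char s ⇒ t x)

  possible : ∀ s → ⊢ ⟨ [] ⟩ char s
  possible s = MP Comp (⋀-elim (∈-map⁺ (λ Y → ⟨ [] ⟩ cn Y Atm₀) (sel∈sublists s Atm₀)))

  functional : ∀ s x → ⊢ (char s ∧ t x ⇒ assigns s x)
  functional s x = MP (Func x)
    (⋀-elim (∈-map⁺ (λ Y → (cn Y Atm₀ ∧ t x) ⇒ [ [] ] (cn Y Atm₀ ⇒ t x)) (sel∈sublists s Atm₀)))

  -- If no [∅](char s → t x) held, Func and axiom 5 would give [∅]¬(char s ∧ t x) for every x,
  -- hence [∅]¬ char s by AtLeast, contradicting Comp.
  decide : ∀ s {A φ} → (∀ x → ⊢ (A ∧ assigns s x ⇒ φ)) → ⊢ (A ⇒ φ)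
  decide s {A} {φ} h = by-contradiction (⇒-mp (⇒-trans excluded □-K) (⇒-const (Nec∅ AtLeast))) (possible s)
    where
    refuted : ∀ x → ⊢ (A ∧ ¬' φ ⇒ □ (¬' (char s ∧ t x)))
    refuted x = ⇒-trans (MP (h x) (tautology ((α & β ⊃ γ) ⊃ α & ~ γ ⊃ ~ β) (A ∷ assigns s x ∷ φ ∷ [])))
                        (⇒-trans five (□-mono (contraposition (functional s x))))
    no-value : ⊢ (⋀ (map (λ x → ¬' (char s ∧ t x)) values) ⇒ ⋁ (map t values) ⇒ ¬' char s)
    no-value = ⋁-elim (map⁺ (All.universal excludes values))
      where
      excludes : ∀ x → ⊢ (⋀ (map (λ x → ¬' (char s ∧ t x)) values) ⇒ t x ⇒ ¬' char s)
      excludes x = ⇒-trans (⋀-elim (∈-map⁺ (λ x → ¬' (char s ∧ t x)) (∈-allFin x)))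
                           (tautology (~ (α & β) ⊃ β ⊃ ~ α) (char s ∷ t x ∷ []))
    excluded : ⊢ (A ∧ ¬' φ ⇒ □ (⋁ (map t values) ⇒ ¬' char s))
    excluded = ⇒-trans (□-⋀ (map⁺ (All.universal refuted values))) (□-mono no-value)

  graphOn : (State → Val) → List State → Fm
  graphOn g L = ⋀ (map (λ s → assigns s (g s)) L)

  _≟ₛ_ : (s s' : State) → Dec (s ≡ s')
  _≟ₛ_ = ≡-dec B._≟_

  _[_↦_] : (State → Val) → State → Val → State → Val
  (g [ s ↦ x ]) s' with s' ≟ₛ s
  ... | yes _ = x
  ... | no _ = g s'

  -- Once decide has fixed the value x at s, every g chosen for the remaining states
  -- extends to g [ s ↦ x ].
  choose : ∀ L {A φ} → (∀ g → ⊢ (A ∧ graphOn g L ⇒ φ)) → ⊢ (A ⇒ φ)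
  choose [] h = ⇒-trans (⇒-∧ ⇒-refl (⇒-const ⊤-intro)) (h (λ _ → zero))
  choose (s ∷ L) {A} h = decide s λ x → choose L λ g → ⇒-trans (extend g x) (h (g [ s ↦ x ]))
    where
    updated : ∀ g x {s'} → s' ∈ s ∷ L → ⊢ ((A ∧ assigns s x) ∧ graphOn g L ⇒ assigns s' ((g [ s ↦ x ]) s'))
    updated g x {s'} s'∈ with s' ≟ₛ s
    ... | yes refl = ⇒-trans ∧-elimˡ ∧-elimʳ
    ... | no s'≢s = ⇒-trans ∧-elimʳ (⋀-elim (∈-map⁺ (λ s → assigns s (g s)) (Any.tail s'≢s s'∈)))
    extend : ∀ g x → ⊢ ((A ∧ assigns s x) ∧ graphOn g L ⇒ A ∧ graphOn (g [ s ↦ x ]) (s ∷ L))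
    extend g x = ⇒-∧ (⇒-trans ∧-elimˡ ∧-elimˡ) (⋀-intro (map⁺ (All.tabulate (updated g x))))

  module Canonical (f : State → Val) where

    graph : Fm
    graph = graphOn f (subsets n)

    pointed : State → Fm
    pointed s = graph ∧ char s

    some-state : ⊢ ⋁ (map char (subsets n))
    some-state = boolean-complete f (⋁-boolean (map⁺ (All.universal char-boolean (subsets n))))
      λ s → eval-⋁⁺ (∈-map⁺ char (∈-subsets s)) (eval-char-self s)

    cases : ∀ {A B} → (∀ s → ⊢ (A ∧ char s ⇒ B)) → ⊢ (A ⇒ B)
    cases h = ⇒-mp (⋁-elim (map⁺ (All.universal (curry ∘ h) (subsets n)))) (⇒-const some-state)

    graph-assigns : ∀ s → ⊢ (graph ⇒ assigns s (f s))
    graph-assigns s = ⋀-elim (∈-map⁺ (λ s → assigns s (f s)) (∈-subsets s))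

    graph-□ : ⊢ (graph ⇒ □ graph)
    graph-□ = □-⋀ (map⁺ (All.universal (λ s → ⇒-trans (graph-assigns s) (4∅ _)) (subsets n)))

    assigned : ∀ s → ⊢ (pointed s ⇒ t (f s))
    assigned s = uncurry (⇒-trans (graph-assigns s) (T∅ _))

    everywhere-□ : ∀ {θ} → (∀ s → ⊢ (pointed s ⇒ θ)) → ⊢ (graph ⇒ □ θ)
    everywhere-□ h = ⇒-trans graph-□ (□-mono (cases h))

    somewhere-¬□ : ∀ {θ} s → ⊢ (pointed s ⇒ ¬' θ) → ⊢ (graph ⇒ ¬' □ θ)
    somewhere-¬□ {θ} s d = ⇒-tollens (⇒-trans (everywhere-□ refuting) □-K) (possible s)
      where
      refuting : ∀ s' → ⊢ (pointed s' ⇒ θ ⇒ ¬' char s)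
      refuting _ = ⇒-trans ∧-elimˡ (⇒-trans (curry d) (tautology ((α ⊃ ~ β) ⊃ β ⊃ ~ α) (char s ∷ θ ∷ [])))

    box-truth : ∀ {θ} → (∀ s → Decides (pointed s) θ (eval f s θ)) →
                Decides graph (□ θ) (allS {n} (λ s → eval f s θ))
    box-truth {θ} h with allS {n} (λ s → eval f s θ) in θ-everywhere
    ... | true = proves (everywhere-□ λ s → decides-true (h s) (allS⁻ θ-everywhere s))
    ... | false with allS-counterexample θ-everywhere
    ...   | s , θ-fails = refutes (somewhere-¬□ s (decides-false (h s) θ-fails))

    -- Of the conjuncts of Red□, only the one for sel s X is not vacuous below char s.
    box-local : ∀ s X θ → ⊢ (char s ⇒ ([ X ] θ ⇔' □ (cn (sel s X) X ⇒ θ)))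
    box-local s X θ = ⇒-∧ forth back
      where
      R : List (Fin n) → Fm
      R Y = cn Y X ⇒ □ (cn Y X ⇒ θ)
      Y₀ : List (Fin n)
      Y₀ = sel s X
      at-Y₀ : ⊢ (char s ⇒ cn Y₀ X)
      at-Y₀ = decides-true (char-decides f (cn-boolean Y₀ X) s) (eval-cn-sel {f} {s} {s} {X} (agree-refl X s))
      forth : ⊢ (char s ⇒ [ X ] θ ⇒ □ (cn Y₀ X ⇒ θ))
      forth = curry (⇒-mp (⇒-trans ∧-elimʳ (⇒-trans (⇔-elimˡ (Red□ X θ)) (⋀-elim (∈-map⁺ R (sel∈sublists s X)))))
                          (⇒-trans ∧-elimˡ at-Y₀))
      conjunct : ∀ Y → ⊢ (char s ∧ □ (cn Y₀ X ⇒ θ) ⇒ R Y)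
      conjunct Y with eval f s (cn Y X) in Y-at-s
      ... | false = ⇒-trans ∧-elimˡ (⇒-absurd (decides-false (char-decides f (cn-boolean Y X) s) Y-at-s))
      ... | true = ⇒-trans ∧-elimʳ (⇒-weaken (□-mono (⇒-precompose Y⇒Y₀)))
        where
        Y⇒Y₀ : ⊢ (cn Y X ⇒ cn Y₀ X)
        Y⇒Y₀ = boolean-complete f (¬' (cn-boolean Y X ∧ ¬' cn-boolean Y₀ X)) λ s' →
          ⇒ᵇ⁺ λ (h : eval f s' (cn Y X) ≡ true) →
            eval-cn-sel {f} {s} {s'} {X} (cn-agree {f} {s} {s'} {Y} {X} Y-at-s h)
      back : ⊢ (char s ⇒ □ (cn Y₀ X ⇒ θ) ⇒ [ X ] θ)
      back = curry (⇒-trans (⋀-intro (map⁺ (All.universal conjunct (sublists X)))) (⇔-elimʳ (Red□ X θ)))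

    box-local-eval : ∀ s X θ → eval f s (□ (cn (sel s X) X ⇒ θ)) ≡ eval f s ([ X ] θ)
    box-local-eval s X θ = sym (⇔ᵇ⁻ (⇒ᵇ⁻ (sound (box-local s X θ) f s) (eval-char-self s)))

    truth : ∀ {φ} → Static φ → ∀ s → Decides (pointed s) φ (eval f s φ)
    truth (p i) s = decides-weaken ∧-elimʳ (char-decides f (p i) s)
    truth (t y) s with f s F.≟ y
    ... | yes refl = proves (assigned s)
    ... | no fs≢y = refutes (⇒-trans (assigned s) (AtMost (f s) y fs≢y))
    truth (¬' sφ) s = decides-¬ (truth sφ s)
    truth (sφ ∧ sψ) s = decides-∧ (truth sφ s) (truth sψ s)
    truth {[ X ] θ} ([ X ] sθ) s = subst (Decides (pointed s) ([ X ] θ)) (box-local-eval s X θ)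
      (decides-⇔ (⇒-trans ∧-elimʳ (box-local s X θ)) (decides-weaken ∧-elimˡ (box-truth restricted)))
      where
      restricted : ∀ s' → Decides (pointed s') (cn (sel s X) X ⇒ θ) (eval f s' (cn (sel s X) X ⇒ θ))
      restricted s' = decides-¬ (decides-∧ (decides-weaken ∧-elimʳ (char-decides f (cn-boolean (sel s X) X) s'))
                                           (decides-¬ (truth sθ s')))

    graph-proves : ∀ {φ} → Valid φ → ⊢ (graph ⇒ φ)
    graph-proves {φ} valid =
      ⇒-trans (cases λ s → decides-true (truth (reduce-static φ) s) (reduce-valid s)) (⇔-elimʳ (reduce-⇔ φ))
      where
      reduce-valid : ∀ s → eval f s (reduce φ) ≡ true
      reduce-valid s = trans (sym (⇔ᵇ⁻ (sound (reduce-⇔ φ) f s))) (valid ⟨S, f ⟩ s)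

  completeness : ∀ {φ} → Valid φ → ⊢ φ
  completeness valid = MP ⊤-intro (choose (subsets n) λ g → ⇒-trans ∧-elimʳ (Canonical.graph-proves g valid))

theorem3 : (n k : ℕ) (φ : Logic.Fm n k) → (Logic.⊢_ n k φ) ⇔ Logic.Valid n k φ
theorem3 n k φ = mk⇔ (Semantics.soundness n k) (Completeness.completeness n k)
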